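{- Let $G$ be a graph on $n$ vertices. If $n$ is odd and $\Gamma(G)\le 4$, or if $n$ is even and $\Gamma(G)\le 3$, then $D(G,x)$ is unimodal with a mode at $\lceil n/2\rceil$ or $\lceil n/2\rceil+1$.
   Context: $G$ is a finite simple graph. A set $U\subseteq V(G)$ is dominating if every vertex is in $U$ or adjacent to a vertex of $U$; $d_i(G)$ is the number of dominating sets of size $i$, and $D(G,x)=\sum_{i=1}^n d_i(G)x^i$ is the domination polynomial. The upper domination number $\Gamma(G)$ is the maximum size of a minimal (with respect to inclusion) dominating set. A polynomial is unimodal if its coefficients (ordered by increasing power of $x$) are non-decreasing and then non-increasing; it has a mode at $k$ if the coefficient of $x^k$ is the maximum coefficient. -}

module Defs where

open import Data.Bool using (Bool; true; false)
open import Data.Bool.Properties using () renaming (_≟_ to _≟ᵇ_)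
open import Data.Nat using (ℕ; zero; suc; _≤_)
open import Data.Nat.Properties using (_≟_)
open import Data.Fin using (Fin)
open import Data.Fin.Properties using (all?; any?)
open import Data.Fin.Subset using (Subset; _∈_; _⊂_; ∣_∣)
open import Data.Fin.Subset.Properties using (_∈?_)
open import Data.Vec using (Vec; []; _∷_)
open import Data.List using (List; []; _∷_; map; _++_; filter; length)
open import Data.Product using (Σ; ∃; _×_; _,_)
open import Data.Sum using (_⊎_)
open import Relation.Nullary using (¬_; Dec)
open import Relation.Nullary.Decidable using (_×-dec_; _⊎-dec_)
open import Relation.Binary.PropositionalEquality using (_≡_)

record Graph (n : ℕ) : Set where
  field
    adj     : Fin n → Fin n → Bool
    symm    : ∀ u v → adj u v ≡ adj v u
    irrefl  : ∀ v → adj v v ≡ false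
open Graph public

Dominating : ∀ {n} → Graph n → Subset n → Set
Dominating {n} G U = (v : Fin n) → v ∈ U ⊎ ∃ λ (u : Fin n) → u ∈ U × adj G u v ≡ true

dominating? : ∀ {n} (G : Graph n) (U : Subset n) → Dec (Dominating G U)
dominating? G U = all? (λ v → (v ∈? U) ⊎-dec any? (λ u → (u ∈? U) ×-dec (adj G u v ≟ᵇ true)))

MinimalDominating : ∀ {n} → Graph n → Subset n → Set
MinimalDominating G U = Dominating G U × (∀ W → W ⊂ U → ¬ Dominating G W)

UpperDomAtMost : ∀ {n} → Graph n → ℕ → Set
UpperDomAtMost G k = ∀ U → MinimalDominating G U → ∣ U ∣ ≤ k

allSubsets : (n : ℕ) → List (Subset n)
allSubsets zero    = [] ∷ []
allSubsets (suc n) = map (true ∷_) (allSubsets n) ++ map (false ∷_) (allSubsets n)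

domCount : ∀ {n} → Graph n → ℕ → ℕ
domCount {n} G i = length (filter (λ U → (∣ U ∣ ≟ i) ×-dec dominating? G U) (allSubsets n))

-- Coefficient of x^i in D(G,x) = Σ_{i=1}^n d_i(G) x^i (coefficient of x^0 is 0).
domCoeff : ∀ {n} → Graph n → ℕ → ℕ
domCoeff G zero    = 0
domCoeff G (suc i) = domCount G (suc i)

Unimodal : (ℕ → ℕ) → Set
Unimodal c = ∃ λ k → (∀ i j → i ≤ j → j ≤ k → c i ≤ c j)
                   × (∀ i j → k ≤ i → i ≤ j → c j ≤ c i)

ModeAt : (ℕ → ℕ) → ℕ → Set
ModeAt c k = ∀ i → c i ≤ c k

-- Double count the pairs S ⊂ T with S dominating, ∣ S ∣ = i and ∣ T ∣ = i + 1.
-- Each such S has n − i supersets T, all dominating.  A dominating T has at most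
-- i + 1 such subsets, and at least i + 1 − Γ: if M ⊆ T is a minimal dominating set,
-- then T ∖ {v} is dominating for every v ∉ M.  Hence
--   (i + 1 − Γ) d_{i+1} ≤ (n − i) d_i ≤ (i + 1) d_{i+1},
-- so d_i increases while 2i + 1 ≤ n and decreases once 2i + 1 ≥ n + Γ.  When
-- Γ ≤ 3 + (n mod 2) only the step from ⌈n/2⌉ to ⌈n/2⌉ + 1 is left undecided.

module Submission where

open import Defs
open import Data.Nat using (ℕ; zero; suc; _+_; _*_; _∸_; _≤_; _<_; z≤n; s≤s; _%_; ⌈_/2⌉; s≤s⁻¹; _≤′_; ≤′-refl; ≤′-step; >-nonZero)
open import Data.Nat.Properties
open import Data.Nat.DivMod using (m%n<n)
open import Algebra.Properties.CommutativeSemigroup +-commutativeSemigroup using (interchange)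
open import Data.Fin.Subset using (Subset; inside; outside; _⊆_; _⊂_; ∣_∣)
open import Data.Fin.Subset.Properties using (∣p∣≤n; ⊆-refl; ⊆-trans; p⊂q⇒p⊆q; out⊆; s⊆s; drop-∷-⊆; _⊂?_; anySubset?)
open import Data.Fin.Subset.Induction using (⊂-wellFounded)
open import Data.List using (List; []; _∷_; map; _++_; filter; length)
open import Data.List.Properties using (filter-none; length-map)
open import Data.List.Relation.Unary.All as All using (All; []; _∷_)
open import Data.List.Relation.Unary.All.Properties using (map⁺; map⁻)
open import Data.Product using (∃-syntax; _×_; _,_; map₂)
open import Data.Sum using (_⊎_; inj₁; inj₂; [_,_]′)
open import Data.Vec using ([]; _∷_; here)
open import Function using (_∘_)
open import Induction.WellFounded using (Acc; acc)
open import Level using (Level)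
open import Relation.Nullary using (Dec; yes; no; ¬_; contradiction)
open import Relation.Nullary.Decidable using (_×-dec_)
open import Relation.Unary using (Pred; Decidable)
open import Relation.Binary.PropositionalEquality

private
  variable
    a ℓ : Level
    A B : Set a
    n : ℕ

∑ : List A → (A → ℕ) → ℕ
∑ []       f = 0
∑ (x ∷ xs) f = f x + ∑ xs f

∑-++ : ∀ (xs ys : List A) f → ∑ (xs ++ ys) f ≡ ∑ xs f + ∑ ys f
∑-++ []       ys f = refl
∑-++ (x ∷ xs) ys f = trans (cong (f x +_) (∑-++ xs ys f)) (sym (+-assoc (f x) _ _))

∑-map : ∀ (g : B → A) xs f → ∑ (map g xs) f ≡ ∑ xs (f ∘ g)
∑-map g []       f = refl
∑-map g (x ∷ xs) f = cong (f (g x) +_) (∑-map g xs f)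

∑-cong : ∀ (xs : List A) {f g} → (∀ x → f x ≡ g x) → ∑ xs f ≡ ∑ xs g
∑-cong []       f≗g = refl
∑-cong (x ∷ xs) f≗g = cong₂ _+_ (f≗g x) (∑-cong xs f≗g)

∑-mono : ∀ (xs : List A) {f g} → (∀ x → f x ≤ g x) → ∑ xs f ≤ ∑ xs g
∑-mono []       f≤g = z≤n
∑-mono (x ∷ xs) f≤g = +-mono-≤ (f≤g x) (∑-mono xs f≤g)

∑-+ : ∀ (xs : List A) f g → ∑ xs (λ x → f x + g x) ≡ ∑ xs f + ∑ xs g
∑-+ []       f g = refl
∑-+ (x ∷ xs) f g = trans (cong (f x + g x +_) (∑-+ xs f g)) (interchange (f x) (g x) (∑ xs f) (∑ xs g))

∑-*ˡ : ∀ (xs : List A) c f → ∑ xs (λ x → c * f x) ≡ c * ∑ xs f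
∑-*ˡ []       c f = sym (*-zeroʳ c)
∑-*ˡ (x ∷ xs) c f = trans (cong (c * f x +_) (∑-*ˡ xs c f)) (sym (*-distribˡ-+ c (f x) (∑ xs f)))

𝟙 : Dec A → ℕ
𝟙 (yes _) = 1
𝟙 (no _)  = 0

module _ {P : Pred A ℓ} (P? : Decidable P) where

  length-filter≡∑𝟙 : ∀ xs → length (filter P? xs) ≡ ∑ xs (𝟙 ∘ P?)
  length-filter≡∑𝟙 []       = refl
  length-filter≡∑𝟙 (x ∷ xs) with P? x
  ... | yes _ = cong suc (length-filter≡∑𝟙 xs)
  ... | no  _ = length-filter≡∑𝟙 xs

  ∑𝟙≤length : ∀ xs → ∑ xs (𝟙 ∘ P?) ≤ length xs
  ∑𝟙≤length []       = z≤n
  ∑𝟙≤length (x ∷ xs) with P? x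
  ... | yes _ = s≤s (∑𝟙≤length xs)
  ... | no  _ = m≤n⇒m≤1+n (∑𝟙≤length xs)

  ∑𝟙-none : ∀ {xs} → All (¬_ ∘ P) xs → ∑ xs (𝟙 ∘ P?) ≡ 0
  ∑𝟙-none {xs} ¬Pxs = trans (sym (length-filter≡∑𝟙 xs)) (cong length (filter-none P? ¬Pxs))

∑-allSubsets-suc : ∀ n (f : Subset (suc n) → ℕ) →
  ∑ (allSubsets (suc n)) f ≡ ∑ (allSubsets n) (f ∘ (inside ∷_)) + ∑ (allSubsets n) (f ∘ (outside ∷_))
∑-allSubsets-suc n f =
  trans (∑-++ (map (inside ∷_) (allSubsets n)) _ f)
        (cong₂ _+_ (∑-map (inside ∷_) (allSubsets n) f) (∑-map (outside ∷_) (allSubsets n) f))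

removals : Subset n → List (Subset n)
removals []            = []
removals (inside ∷ p)  = (outside ∷ p) ∷ map (inside ∷_) (removals p)
removals (outside ∷ p) = map (outside ∷_) (removals p)

removals-⊆ : ∀ (p : Subset n) → All (_⊆ p) (removals p)
removals-⊆ []            = []
removals-⊆ (inside ∷ p)  = out⊆ ⊆-refl ∷ map⁺ (All.map s⊆s (removals-⊆ p))
removals-⊆ (outside ∷ p) = map⁺ (All.map s⊆s (removals-⊆ p))

removals-size : ∀ (p : Subset n) → All (λ q → suc ∣ q ∣ ≡ ∣ p ∣) (removals p)
removals-size []            = []
removals-size (inside ∷ p)  = refl ∷ map⁺ (All.map (cong suc) (removals-size p))
removals-size (outside ∷ p) = map⁺ (removals-size p)

length-removals : ∀ (p : Subset n) → length (removals p) ≡ ∣ p ∣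
length-removals []            = refl
length-removals (inside ∷ p)  = cong suc (trans (length-map (inside ∷_) (removals p)) (length-removals p))
length-removals (outside ∷ p) = trans (length-map (outside ∷_) (removals p)) (length-removals p)

∑-removals-inside : ∀ (p : Subset n) f →
  ∑ (removals (inside ∷ p)) f ≡ f (outside ∷ p) + ∑ (removals p) (f ∘ (inside ∷_))
∑-removals-inside p f = cong (f (outside ∷ p) +_) (∑-map (inside ∷_) (removals p) f)

∑-removals-outside : ∀ (p : Subset n) f →
  ∑ (removals (outside ∷ p)) f ≡ ∑ (removals p) (f ∘ (outside ∷_))
∑-removals-outside p f = ∑-map (outside ∷_) (removals p) f

-- Each q is a removal of exactly n ∸ ∣ q ∣ subsets, namely q ∪ {v} for v ∉ q.
∑-removals : ∀ n (f : Subset n → ℕ) →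
  ∑ (allSubsets n) (λ p → ∑ (removals p) f) ≡ ∑ (allSubsets n) (λ q → (n ∸ ∣ q ∣) * f q)
∑-removals zero    f = refl
∑-removals (suc n) f = begin
  ∑ (allSubsets (suc n)) (λ p → ∑ (removals p) f)
    ≡⟨ ∑-allSubsets-suc n (λ p → ∑ (removals p) f) ⟩
  ∑ S (λ p → ∑ (removals (inside ∷ p)) f) + ∑ S (λ p → ∑ (removals (outside ∷ p)) f)
    ≡⟨ cong₂ _+_ (trans (∑-cong S (λ p → ∑-removals-inside p f)) (∑-+ S fₒ _))
                 (∑-cong S (λ p → ∑-removals-outside p f)) ⟩
  (∑ S fₒ + ∑ S (λ p → ∑ (removals p) fᵢ)) + ∑ S (λ p → ∑ (removals p) fₒ)
    ≡⟨ cong₂ (λ x y → (∑ S fₒ + x) + y) (∑-removals n fᵢ) (∑-removals n fₒ) ⟩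
  (∑ S fₒ + ∑ S (weighted fᵢ)) + ∑ S (weighted fₒ)
    ≡⟨ cong (_+ ∑ S (weighted fₒ)) (+-comm (∑ S fₒ) _) ⟩
  (∑ S (weighted fᵢ) + ∑ S fₒ) + ∑ S (weighted fₒ)
    ≡⟨ +-assoc (∑ S (weighted fᵢ)) _ _ ⟩
  ∑ S (weighted fᵢ) + (∑ S fₒ + ∑ S (weighted fₒ))
    ≡⟨ cong (∑ S (weighted fᵢ) +_) (sym (trans (∑-cong S outsideWeight) (∑-+ S fₒ (weighted fₒ)))) ⟩
  ∑ S (weighted fᵢ) + ∑ S (λ q → (suc n ∸ ∣ q ∣) * fₒ q)
    ≡⟨ sym (∑-allSubsets-suc n (λ q → (suc n ∸ ∣ q ∣) * f q)) ⟩
  ∑ (allSubsets (suc n)) (λ q → (suc n ∸ ∣ q ∣) * f q) ∎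
  where
  open ≡-Reasoning
  S = allSubsets n
  fᵢ fₒ : Subset n → ℕ
  fᵢ = f ∘ (inside ∷_)
  fₒ = f ∘ (outside ∷_)
  weighted : (Subset n → ℕ) → Subset n → ℕ
  weighted g q = (n ∸ ∣ q ∣) * g q
  outsideWeight : ∀ q → (suc n ∸ ∣ q ∣) * fₒ q ≡ fₒ q + weighted fₒ q
  outsideWeight q = cong (_* fₒ q) (+-∸-assoc 1 (∣p∣≤n q))

-- The ∣ p ∣ ∸ ∣ m ∣ removals p ∖ {v} with v ∉ m all contain m.
∣p∣≤∑𝟙[removals]+∣m∣ : ∀ {P : Pred (Subset n) ℓ} (P? : Decidable P) (p m : Subset n) → m ⊆ p →
  All (λ q → m ⊆ q → P q) (removals p) → ∣ p ∣ ≤ ∑ (removals p) (𝟙 ∘ P?) + ∣ m ∣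
∣p∣≤∑𝟙[removals]+∣m∣ P? []            []            _   _        = z≤n
∣p∣≤∑𝟙[removals]+∣m∣ P? (outside ∷ p) (inside ∷ m)  m⊆p _        with () ← m⊆p here
∣p∣≤∑𝟙[removals]+∣m∣ P? (inside ∷ p)  (inside ∷ m)  m⊆p (_ ∷ hs) = begin
  suc ∣ p ∣                                      ≤⟨ s≤s (∣p∣≤∑𝟙[removals]+∣m∣ (P? ∘ (inside ∷_)) p m (drop-∷-⊆ m⊆p)
                                                      (All.map (_∘ s⊆s) (map⁻ hs))) ⟩
  suc (c + ∣ m ∣)                                ≡⟨ +-suc c ∣ m ∣ ⟨
  c + suc ∣ m ∣                                  ≤⟨ m≤n+m _ (𝟙 (P? (outside ∷ p))) ⟩
  𝟙 (P? (outside ∷ p)) + (c + suc ∣ m ∣)         ≡⟨ +-assoc (𝟙 (P? (outside ∷ p))) c (suc ∣ m ∣) ⟨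
  (𝟙 (P? (outside ∷ p)) + c) + suc ∣ m ∣         ≡⟨ cong (_+ suc ∣ m ∣) (∑-removals-inside p (𝟙 ∘ P?)) ⟨
  ∑ (removals (inside ∷ p)) (𝟙 ∘ P?) + suc ∣ m ∣ ∎
  where
  open ≤-Reasoning
  c = ∑ (removals p) (𝟙 ∘ P? ∘ (inside ∷_))
∣p∣≤∑𝟙[removals]+∣m∣ P? (inside ∷ p)  (outside ∷ m) m⊆p (h ∷ hs) with P? (outside ∷ p)
... | no ¬P[outside∷p] = contradiction (h (out⊆ (drop-∷-⊆ m⊆p))) ¬P[outside∷p]
... | yes _ = begin
  suc ∣ p ∣                                      ≤⟨ s≤s (∣p∣≤∑𝟙[removals]+∣m∣ (P? ∘ (inside ∷_)) p m (drop-∷-⊆ m⊆p)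
                                                      (All.map (_∘ out⊆) (map⁻ hs))) ⟩
  suc (c + ∣ m ∣)                                ≡⟨ cong (λ x → suc x + ∣ m ∣) (∑-map (inside ∷_) (removals p) (𝟙 ∘ P?)) ⟨
  suc (∑ (map (inside ∷_) (removals p)) (𝟙 ∘ P?) + ∣ m ∣) ∎
  where
  open ≤-Reasoning
  c = ∑ (removals p) (𝟙 ∘ P? ∘ (inside ∷_))
∣p∣≤∑𝟙[removals]+∣m∣ P? (outside ∷ p) (outside ∷ m) m⊆p hs = begin
  ∣ p ∣                                          ≤⟨ ∣p∣≤∑𝟙[removals]+∣m∣ (P? ∘ (outside ∷_)) p m (drop-∷-⊆ m⊆p)
                                                      (All.map (_∘ s⊆s) (map⁻ hs)) ⟩
  ∑ (removals p) (𝟙 ∘ P? ∘ (outside ∷_)) + ∣ m ∣ ≡⟨ cong (_+ ∣ m ∣) (∑-removals-outside p (𝟙 ∘ P?)) ⟨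
  ∑ (removals (outside ∷ p)) (𝟙 ∘ P?) + ∣ m ∣   ∎
  where open ≤-Reasoning

∃-⊂-minimal : ∀ {P : Pred (Subset n) ℓ} → Decidable P → ∀ {p} → P p →
  ∃[ m ] m ⊆ p × P m × (∀ w → w ⊂ m → ¬ P w)
∃-⊂-minimal {P = P} P? = descend (⊂-wellFounded _)
  where
  descend : ∀ {p} → Acc _⊂_ p → P p → ∃[ m ] m ⊆ p × P m × (∀ w → w ⊂ m → ¬ P w)
  descend {p} (acc smaller) Pp with anySubset? (λ w → (w ⊂? p) ×-dec P? w)
  ... | no ∄w = p , ⊆-refl , Pp , λ w w⊂p Pw → ∄w (w , w⊂p , Pw)
  ... | yes (w , w⊂p , Pw) with descend (smaller w⊂p) Pw
  ...   | m , m⊆w , Pm , minimal = m , ⊆-trans m⊆w (p⊂q⇒p⊆q w⊂p) , Pm , minimal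

module _ (G : Graph n) where

  dominating-mono : ∀ {p q} → p ⊆ q → Dominating G p → Dominating G q
  dominating-mono p⊆q dom v with dom v
  ... | inj₁ v∈p              = inj₁ (p⊆q v∈p)
  ... | inj₂ (u , u∈p , u~v)  = inj₂ (u , p⊆q u∈p , u~v)

  DominatingOfSize : ℕ → Subset n → Set
  DominatingOfSize i U = ∣ U ∣ ≡ i × Dominating G U

  dominatingOfSize? : ∀ i → Decidable (DominatingOfSize i)
  dominatingOfSize? i U = (∣ U ∣ ≟ i) ×-dec dominating? G U

  domCount≡∑ : ∀ i → domCount G i ≡ ∑ (allSubsets n) (𝟙 ∘ dominatingOfSize? i)
  domCount≡∑ i = length-filter≡∑𝟙 (dominatingOfSize? i) (allSubsets n)

  domCount-oversized : ∀ {i} → n < i → domCount G i ≡ 0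
  domCount-oversized n<i =
    trans (domCount≡∑ _) (∑𝟙-none (dominatingOfSize? _) (All.universal tooLarge (allSubsets n)))
    where
    tooLarge : ∀ U → ¬ DominatingOfSize _ U
    tooLarge U (∣U∣≡i , _) = <⇒≢ (≤-<-trans (∣p∣≤n U) n<i) ∣U∣≡i

  ∑-removals-dominating : ∀ i →
    ∑ (allSubsets n) (λ T → ∑ (removals T) (𝟙 ∘ dominatingOfSize? i)) ≡ (n ∸ i) * domCount G i
  ∑-removals-dominating i = begin
    ∑ (allSubsets n) (λ T → ∑ (removals T) (𝟙 ∘ dominatingOfSize? i))
      ≡⟨ ∑-removals n (𝟙 ∘ dominatingOfSize? i) ⟩
    ∑ (allSubsets n) (λ U → (n ∸ ∣ U ∣) * 𝟙 (dominatingOfSize? i U))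
      ≡⟨ ∑-cong (allSubsets n) weight ⟩
    ∑ (allSubsets n) (λ U → (n ∸ i) * 𝟙 (dominatingOfSize? i U))
      ≡⟨ ∑-*ˡ (allSubsets n) (n ∸ i) (𝟙 ∘ dominatingOfSize? i) ⟩
    (n ∸ i) * ∑ (allSubsets n) (𝟙 ∘ dominatingOfSize? i)
      ≡⟨ cong ((n ∸ i) *_) (domCount≡∑ i) ⟨
    (n ∸ i) * domCount G i ∎
    where
    open ≡-Reasoning
    weight : ∀ U → (n ∸ ∣ U ∣) * 𝟙 (dominatingOfSize? i U) ≡ (n ∸ i) * 𝟙 (dominatingOfSize? i U)
    weight U with dominatingOfSize? i U
    ... | yes (∣U∣≡i , _) = cong (λ k → (n ∸ k) * 1) ∣U∣≡i
    ... | no  _           = trans (*-zeroʳ (n ∸ ∣ U ∣)) (sym (*-zeroʳ (n ∸ i)))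

  ∑𝟙[removals]≤ : ∀ i T → ∑ (removals T) (𝟙 ∘ dominatingOfSize? i) ≤ suc i * 𝟙 (dominatingOfSize? (suc i) T)
  ∑𝟙[removals]≤ i T with dominatingOfSize? (suc i) T
  ... | yes (∣T∣≡1+i , _) = begin
    ∑ (removals T) (𝟙 ∘ dominatingOfSize? i) ≤⟨ ∑𝟙≤length (dominatingOfSize? i) (removals T) ⟩
    length (removals T)                      ≡⟨ trans (length-removals T) ∣T∣≡1+i ⟩
    suc i                                    ≡⟨ *-identityʳ (suc i) ⟨
    suc i * 1                                ∎
    where open ≤-Reasoning
  ... | no ¬D = ≤-reflexive (trans (∑𝟙-none (dominatingOfSize? i) (All.zipWith notSmaller (removals-size T , removals-⊆ T)))
                                   (sym (*-zeroʳ (suc i))))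
    where
    notSmaller : ∀ {q} → suc ∣ q ∣ ≡ ∣ T ∣ × q ⊆ T → ¬ DominatingOfSize i q
    notSmaller (1+∣q∣≡∣T∣ , q⊆T) (∣q∣≡i , domQ) =
      ¬D (trans (sym 1+∣q∣≡∣T∣) (cong suc ∣q∣≡i) , dominating-mono q⊆T domQ)

  ∑𝟙[removals]≥ : ∀ {g} → UpperDomAtMost G g → ∀ i T →
    (suc i ∸ g) * 𝟙 (dominatingOfSize? (suc i) T) ≤ ∑ (removals T) (𝟙 ∘ dominatingOfSize? i)
  ∑𝟙[removals]≥ {g} Γ≤g i T with dominatingOfSize? (suc i) T
  ... | no _ = ≤-trans (≤-reflexive (*-zeroʳ (suc i ∸ g))) z≤n
  ... | yes (∣T∣≡1+i , domT) with ∃-⊂-minimal (dominating? G) domT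
  ...   | m , m⊆T , domM , minimal =
    ≤-trans (≤-reflexive (*-identityʳ (suc i ∸ g))) (m≤n+o⇒m∸n≤o (suc i) g 1+i≤g+c)
    where
    c = ∑ (removals T) (𝟙 ∘ dominatingOfSize? i)
    sizedSupersets : All (λ q → m ⊆ q → DominatingOfSize i q) (removals T)
    sizedSupersets = All.map sized (removals-size T)
      where
      sized : ∀ {q} → suc ∣ q ∣ ≡ ∣ T ∣ → m ⊆ q → DominatingOfSize i q
      sized 1+∣q∣≡∣T∣ m⊆q = suc-injective (trans 1+∣q∣≡∣T∣ ∣T∣≡1+i) , dominating-mono m⊆q domM
    1+i≤g+c : suc i ≤ g + c
    1+i≤g+c = begin
      suc i     ≡⟨ ∣T∣≡1+i ⟨
      ∣ T ∣     ≤⟨ ∣p∣≤∑𝟙[removals]+∣m∣ (dominatingOfSize? i) T m m⊆T sizedSupersets ⟩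
      c + ∣ m ∣ ≤⟨ +-monoʳ-≤ c (Γ≤g m (domM , minimal)) ⟩
      c + g     ≡⟨ +-comm c g ⟩
      g + c     ∎
      where open ≤-Reasoning

  domCount-pairs-upper : ∀ i → (n ∸ i) * domCount G i ≤ suc i * domCount G (suc i)
  domCount-pairs-upper i = begin
    (n ∸ i) * domCount G i
      ≡⟨ ∑-removals-dominating i ⟨
    ∑ (allSubsets n) (λ T → ∑ (removals T) (𝟙 ∘ dominatingOfSize? i))
      ≤⟨ ∑-mono (allSubsets n) (∑𝟙[removals]≤ i) ⟩
    ∑ (allSubsets n) (λ T → suc i * 𝟙 (dominatingOfSize? (suc i) T))
      ≡⟨ ∑-*ˡ (allSubsets n) (suc i) (𝟙 ∘ dominatingOfSize? (suc i)) ⟩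
    suc i * ∑ (allSubsets n) (𝟙 ∘ dominatingOfSize? (suc i))
      ≡⟨ cong (suc i *_) (domCount≡∑ (suc i)) ⟨
    suc i * domCount G (suc i) ∎
    where open ≤-Reasoning

  domCount-pairs-lower : ∀ {g} → UpperDomAtMost G g → ∀ i → (suc i ∸ g) * domCount G (suc i) ≤ (n ∸ i) * domCount G i
  domCount-pairs-lower {g} Γ≤g i = begin
    (suc i ∸ g) * domCount G (suc i)
      ≡⟨ cong ((suc i ∸ g) *_) (domCount≡∑ (suc i)) ⟩
    (suc i ∸ g) * ∑ (allSubsets n) (𝟙 ∘ dominatingOfSize? (suc i))
      ≡⟨ ∑-*ˡ (allSubsets n) (suc i ∸ g) (𝟙 ∘ dominatingOfSize? (suc i)) ⟨
    ∑ (allSubsets n) (λ T → (suc i ∸ g) * 𝟙 (dominatingOfSize? (suc i) T))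
      ≤⟨ ∑-mono (allSubsets n) (∑𝟙[removals]≥ Γ≤g i) ⟩
    ∑ (allSubsets n) (λ T → ∑ (removals T) (𝟙 ∘ dominatingOfSize? i))
      ≡⟨ ∑-removals-dominating i ⟩
    (n ∸ i) * domCount G i ∎
    where open ≤-Reasoning

  domCount-ascending : ∀ i → suc i + i ≤ n → domCount G i ≤ domCount G (suc i)
  domCount-ascending i 1+2i≤n = *-cancelˡ-≤ (suc i) (begin
    suc i * domCount G i       ≤⟨ *-monoˡ-≤ (domCount G i) (m+n≤o⇒m≤o∸n (suc i) 1+2i≤n) ⟩
    (n ∸ i) * domCount G i     ≤⟨ domCount-pairs-upper i ⟩
    suc i * domCount G (suc i) ∎)
    where open ≤-Reasoning

  domCount-descending : ∀ {g} → UpperDomAtMost G g → ∀ i → n + g ≤ suc i + i → domCount G (suc i) ≤ domCount G i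
  domCount-descending {g} Γ≤g i n+g≤1+2i with n ≤? i
  ... | yes n≤i = ≤-trans (≤-reflexive (domCount-oversized (s≤s n≤i))) z≤n
  ... | no  n≰i = *-cancelˡ-≤ (n ∸ i) {{>-nonZero (m<n⇒0<n∸m i<n)}} (begin
    (n ∸ i) * domCount G (suc i)     ≤⟨ *-monoˡ-≤ (domCount G (suc i)) (m+n≤o⇒m≤o∸n (n ∸ i) n∸i+g≤1+i) ⟩
    (suc i ∸ g) * domCount G (suc i) ≤⟨ domCount-pairs-lower Γ≤g i ⟩
    (n ∸ i) * domCount G i           ∎)
    where
    open ≤-Reasoning
    i<n : i < n
    i<n = ≰⇒> n≰i
    n∸i+g≤1+i : n ∸ i + g ≤ suc i
    n∸i+g≤1+i = begin
      n ∸ i + g         ≡⟨ +-∸-comm g (<⇒≤ i<n) ⟨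
      (n + g) ∸ i       ≤⟨ ∸-monoˡ-≤ i n+g≤1+2i ⟩
      (suc i + i) ∸ i   ≡⟨ m+n∸n≡m (suc i) i ⟩
      suc i             ∎

stepwise⇒unimodal : ∀ (c : ℕ → ℕ) k → (∀ i → i < k → c i ≤ c (suc i)) → (∀ i → k ≤ i → c (suc i) ≤ c i) →
  Unimodal c × ModeAt c k
stepwise⇒unimodal c k up down = (k , ascend , descend) , mode
  where
  ascend′ : ∀ {i j} → i ≤′ j → j ≤ k → c i ≤ c j
  ascend′ ≤′-refl            _     = ≤-refl
  ascend′ (≤′-step {j} i≤′j) 1+j≤k = ≤-trans (ascend′ i≤′j (<⇒≤ 1+j≤k)) (up j 1+j≤k)
  descend′ : ∀ {i j} → k ≤ i → i ≤′ j → c j ≤ c i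
  descend′ _   ≤′-refl            = ≤-refl
  descend′ k≤i (≤′-step {j} i≤′j) = ≤-trans (down j (≤-trans k≤i (≤′⇒≤ i≤′j))) (descend′ k≤i i≤′j)
  ascend : ∀ i j → i ≤ j → j ≤ k → c i ≤ c j
  ascend i j i≤j = ascend′ (≤⇒≤′ i≤j)
  descend : ∀ i j → k ≤ i → i ≤ j → c j ≤ c i
  descend i j k≤i i≤j = descend′ k≤i (≤⇒≤′ i≤j)
  mode : ModeAt c k
  mode i with ≤-total i k
  ... | inj₁ i≤k = ascend i k i≤k ≤-refl
  ... | inj₂ k≤i = descend k i ≤-refl k≤i

stepwise⇒unimodal-mode-at-k∨k+1 : ∀ (c : ℕ → ℕ) k →
  (∀ i → i < k → c i ≤ c (suc i)) → (∀ i → suc k ≤ i → c (suc i) ≤ c i) →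
  Unimodal c × (ModeAt c k ⊎ ModeAt c (k + 1))
stepwise⇒unimodal-mode-at-k∨k+1 c k up down with c (suc k) ≤? c k
... | yes fallAtK = map₂ inj₁ (stepwise⇒unimodal c k up down′)
  where
  down′ : ∀ i → k ≤ i → c (suc i) ≤ c i
  down′ i k≤i with m≤n⇒m<n∨m≡n k≤i
  ... | inj₁ k<i  = down i k<i
  ... | inj₂ refl = fallAtK
... | no ¬fallAtK = map₂ (inj₂ ∘ subst (ModeAt c) (+-comm 1 k)) (stepwise⇒unimodal c (suc k) up′ down)
  where
  up′ : ∀ i → i < suc k → c i ≤ c (suc i)
  up′ i i<1+k with m<1+n⇒m<n∨m≡n i<1+k
  ... | inj₁ i<k  = up i i<k
  ... | inj₂ refl = <⇒≤ (≰⇒> ¬fallAtK)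

⌈n/2⌉+⌈n/2⌉≡n+n%2 : ∀ n → ⌈ n /2⌉ + ⌈ n /2⌉ ≡ n + n % 2
⌈n/2⌉+⌈n/2⌉≡n+n%2 zero          = refl
⌈n/2⌉+⌈n/2⌉≡n+n%2 (suc zero)    = refl
⌈n/2⌉+⌈n/2⌉≡n+n%2 (suc (suc n)) =
  cong suc (trans (+-suc ⌈ n /2⌉ ⌈ n /2⌉) (cong suc (⌈n/2⌉+⌈n/2⌉≡n+n%2 n)))

i<⌈n/2⌉⇒1+2i≤n : ∀ {i} n → i < ⌈ n /2⌉ → suc i + i ≤ n
i<⌈n/2⌉⇒1+2i≤n {i} n i<⌈n/2⌉ = s≤s⁻¹ (begin
  suc (suc i + i)       ≡⟨ +-suc (suc i) i ⟨
  suc i + suc i         ≤⟨ +-mono-≤ i<⌈n/2⌉ i<⌈n/2⌉ ⟩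
  ⌈ n /2⌉ + ⌈ n /2⌉     ≡⟨ ⌈n/2⌉+⌈n/2⌉≡n+n%2 n ⟩
  n + n % 2             ≤⟨ +-monoʳ-≤ n (s≤s⁻¹ (m%n<n n 2)) ⟩
  n + 1                 ≡⟨ +-comm n 1 ⟩
  suc n                 ∎)
  where open ≤-Reasoning

⌈n/2⌉<i⇒n+3+n%2≤1+2i : ∀ {i} n → ⌈ n /2⌉ < i → n + (3 + n % 2) ≤ suc i + i
⌈n/2⌉<i⇒n+3+n%2≤1+2i {i} n ⌈n/2⌉<i = begin
  n + (3 + n % 2)                       ≡⟨ trans (+-comm n (3 + n % 2)) (cong (3 +_) (+-comm (n % 2) n)) ⟩
  3 + (n + n % 2)                       ≡⟨ cong (3 +_) (⌈n/2⌉+⌈n/2⌉≡n+n%2 n) ⟨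
  3 + (⌈ n /2⌉ + ⌈ n /2⌉)               ≡⟨ cong (2 +_) (+-suc ⌈ n /2⌉ ⌈ n /2⌉) ⟨
  suc (suc ⌈ n /2⌉ + suc ⌈ n /2⌉)       ≤⟨ s≤s (+-mono-≤ ⌈n/2⌉<i ⌈n/2⌉<i) ⟩
  suc i + i                             ∎
  where open ≤-Reasoning

corollary6p3 : (n : ℕ) (G : Graph n) →
    ((n % 2 ≡ 1 × UpperDomAtMost G 4) ⊎ (n % 2 ≡ 0 × UpperDomAtMost G 3)) →
    Unimodal (domCoeff G) × (ModeAt (domCoeff G) ⌈ n /2⌉ ⊎ ModeAt (domCoeff G) (⌈ n /2⌉ + 1))
corollary6p3 n G hypothesis = stepwise⇒unimodal-mode-at-k∨k+1 (domCoeff G) ⌈ n /2⌉ ascent descent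
  where
  Γ≤3+n%2 : UpperDomAtMost G (3 + n % 2)
  Γ≤3+n%2 = [ (λ (odd  , Γ≤4) → subst (λ r → UpperDomAtMost G (3 + r)) (sym odd)  Γ≤4)
            , (λ (even , Γ≤3) → subst (λ r → UpperDomAtMost G (3 + r)) (sym even) Γ≤3) ]′ hypothesis
  ascent : ∀ i → i < ⌈ n /2⌉ → domCoeff G i ≤ domCoeff G (suc i)
  ascent zero    _         = z≤n
  ascent (suc i) 1+i<⌈n/2⌉ = domCount-ascending G (suc i) (i<⌈n/2⌉⇒1+2i≤n n 1+i<⌈n/2⌉)
  descent : ∀ i → suc ⌈ n /2⌉ ≤ i → domCoeff G (suc i) ≤ domCoeff G i
  descent zero    ()
  descent (suc i) ⌈n/2⌉<1+i = domCount-descending G Γ≤3+n%2 (suc i) (⌈n/2⌉<i⇒n+3+n%2≤1+2i n ⌈n/2⌉<1+i)
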